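{- Let $G_1,G_2$ be finite simple connected graphs, $G_i$ having $n_i$ vertices and $m_i$ edges. Then the disjunction $G_1\wedge G_2$ satisfies \begin{align*} F(G_1\wedge G_2)={}&n_2^4F(G_1)+n_1^4F(G_2)-F(G_1)F(G_2)+6n_1n_2^2m_2M_1(G_1)+6n_1^2n_2m_1M_1(G_2)\\ &+3n_2F(G_1)M_1(G_2)+3n_1F(G_2)M_1(G_1)-6n_2^2m_2F(G_1)-6n_1^2m_1F(G_2)\\ &-6n_1n_2M_1(G_1)M_1(G_2). \end{align*}
   Context: The disjunction $G_1\wedge G_2$ has vertex set $V(G_1)\times V(G_2)$, with $(u_1,v_1)$ adjacent to $(u_2,v_2)$ iff $u_1u_2\in E(G_1)$ or $v_1v_2\in E(G_2)$. For a finite simple graph $G$ with vertex degrees $d_G(v)$: $M_1(G)=\sum_{v} d_G(v)^2$ and $F(G)=\sum_{v} d_G(v)^3$. -}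

module Defs where

open import Data.Nat using (ℕ; zero; suc; _+_; _*_; _^_; _<_; _<ᵇ_)
open import Data.Fin using (Fin; zero; suc; toℕ; remQuot)
open import Data.Bool using (Bool; true; false; _∨_; _∧_; if_then_else_)
open import Data.Bool.Properties using (∨-zeroʳ)
open import Data.Product using (_×_; _,_; proj₁; proj₂)
open import Relation.Binary.PropositionalEquality using (_≡_; refl; cong₂; trans)

sumFin : ∀ {n} → (Fin n → ℕ) → ℕ
sumFin {zero}  f = 0
sumFin {suc n} f = f zero + sumFin (λ i → f (suc i))

record Graph (n : ℕ) : Set where
  field
    adj    : Fin n → Fin n → Bool
    sym    : ∀ i j → adj i j ≡ adj j i
    irrefl : ∀ i → adj i i ≡ false
open Graph public

b2n : Bool → ℕ
b2n true  = 1
b2n false = 0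

degree : ∀ {n} → Graph n → Fin n → ℕ
degree G v = sumFin (λ u → b2n (adj G v u))

edges : ∀ {n} → Graph n → ℕ
edges G = sumFin (λ i → sumFin (λ j → b2n (adj G i j ∧ (toℕ i <ᵇ toℕ j))))

M₁ : ∀ {n} → Graph n → ℕ
M₁ G = sumFin (λ v → degree G v ^ 2)

F : ∀ {n} → Graph n → ℕ
F G = sumFin (λ v → degree G v ^ 3)

data Reach {n} (G : Graph n) : Fin n → Fin n → Set where
  here : ∀ {i} → Reach G i i
  step : ∀ {i k j} → adj G i k ≡ true → Reach G k j → Reach G i j

Connected : ∀ {n} → Graph n → Set
Connected {n} G = (0 < n) × (∀ i j → Reach G i j)

-- the two coordinates of a vertex of Fin (n₁ * n₂) ≅ Fin n₁ × Fin n₂ (via remQuot)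
fst₂ : ∀ {n₁} n₂ → Fin (n₁ * n₂) → Fin n₁
fst₂ {n₁} n₂ x = proj₁ (remQuot {n₁} n₂ x)

snd₂ : ∀ {n₁} n₂ → Fin (n₁ * n₂) → Fin n₂
snd₂ {n₁} n₂ x = proj₂ (remQuot {n₁} n₂ x)

disjunction : ∀ {n₁ n₂} → Graph n₁ → Graph n₂ → Graph (n₁ * n₂)
disjunction {n₁} {n₂} G₁ G₂ = record
  { adj    = A
  ; sym    = λ x y → cong₂ _∨_ (sym G₁ (fst₂ {n₁} n₂ x) (fst₂ {n₁} n₂ y)) (sym G₂ (snd₂ {n₁} n₂ x) (snd₂ {n₁} n₂ y))
  ; irrefl = λ x → cong₂ _∨_ (irrefl G₁ (fst₂ {n₁} n₂ x)) (irrefl G₂ (snd₂ {n₁} n₂ x))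
  }
  where
  A : Fin (n₁ * n₂) → Fin (n₁ * n₂) → Bool
  A x y = adj G₁ (fst₂ {n₁} n₂ x) (fst₂ {n₁} n₂ y) ∨ adj G₂ (snd₂ {n₁} n₂ x) (snd₂ {n₁} n₂ y)

module Submission where

-- The vertex (u, v) of G₁ ∧ G₂ is non-adjacent to (i, j) exactly when
-- both u ≁ i and v ≁ j, so by inclusion–exclusion its degree is
--     d(u,v) = n₂·d₁(u) + n₁·d₂(v) − d₁(u)·d₂(v).
-- Both this degree count and the sum of d(u,v)³ are double sums
-- ∑ᵢ ∑ⱼ P(f i, g j) of a bivariate polynomial P; such a double sum factors
-- monomial by monomial into products of power sums ∑ f^p · ∑ g^q.  For
-- the degree sequence of a graph the power sums of order 0..3 are n, 2m
-- (handshake lemma), M₁ and F, so expanding (n₂x + n₁y − xy)³ into ten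
-- monomials expresses F(G₁ ∧ G₂) through these invariants, and a final
-- ring normalisation gives the stated formula.

open import Defs
open import Data.Nat using (ℕ)
open import Data.Integer using (ℤ; +_; _+_; _-_; _*_; _^_)
open import Relation.Binary.PropositionalEquality using (_≡_)

open import Data.Nat as ℕ using (zero; suc; _<ᵇ_)
open import Data.Integer using (0ℤ; 1ℤ; -1ℤ; -_)
import Data.Integer.Properties as ℤP
open import Data.Integer.Solver using (module +-*-Solver)
open +-*-Solver using (solve; _:+_; _:-_; _:*_; _:^_; :-_; con; _:=_)
open import Data.Fin using (Fin; zero; suc; toℕ; combine; _↑ˡ_; _↑ʳ_)
open import Data.Fin.Properties using (remQuot-combine; toℕ-injective)
open import Data.Bool using (Bool; true; false; _∨_; _∧_)
open import Data.List using (List; []; _∷_)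
open import Data.Product using (proj₁; proj₂)
open import Relation.Nullary using (¬_)
open import Data.Empty using (⊥-elim)
open import Relation.Binary.PropositionalEquality
  using (refl; trans; cong; cong₂; module ≡-Reasoning)
import Relation.Binary.PropositionalEquality as Eq
open import Algebra.Properties.Semiring.Sum ℤP.+-*-semiring
  using ( sum; sum-syntax; sum-cong-≗; sum-replicate-zero; ∑-distrib-+; ∑-comm
        ; *-distribˡ-sum; *-distribʳ-sum )

open ≡-Reasoning

sum-ones : ∀ n → ∑[ i < n ] 1ℤ ≡ + n
sum-ones zero    = refl
sum-ones (suc n) = trans (cong (_+_ 1ℤ) (sum-ones n)) (Eq.sym (ℤP.pos-+ 1 n))

pos-sumFin : ∀ {n} (f : Fin n → ℕ) → + sumFin f ≡ ∑[ i < n ] (+ f i)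
pos-sumFin {zero}  f = refl
pos-sumFin {suc n} f =
  trans (ℤP.pos-+ (f zero) _) (cong (_+_ (+ f zero)) (pos-sumFin (λ i → f (suc i))))

sum-↑ : ∀ m {n} (f : Fin (m ℕ.+ n) → ℤ) →
        sum f ≡ ∑[ i < m ] f (i ↑ˡ n) + ∑[ j < n ] f (m ↑ʳ j)
sum-↑ zero    f = Eq.sym (ℤP.+-identityˡ (sum f))
sum-↑ (suc m) f =
  trans (cong (_+_ (f zero)) (sum-↑ m (λ i → f (suc i)))) (Eq.sym (ℤP.+-assoc (f zero) _ _))

sum-combine : ∀ m {n} (f : Fin (m ℕ.* n) → ℤ) →
              sum f ≡ ∑[ i < m ] ∑[ j < n ] f (combine i j)
sum-combine zero        f = refl
sum-combine (suc m) {n} f =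
  trans (sum-↑ n f)
        (cong (_+_ (sum (λ j → f (j ↑ˡ (m ℕ.* n))))) (sum-combine m (λ x → f (n ↑ʳ x))))

∑∑-distrib-+ : ∀ {m n} (f g : Fin m → Fin n → ℤ) →
  ∑[ i < m ] ∑[ j < n ] (f i j + g i j) ≡
  ∑[ i < m ] ∑[ j < n ] f i j + ∑[ i < m ] ∑[ j < n ] g i j
∑∑-distrib-+ f g =
  trans (sum-cong-≗ (λ i → ∑-distrib-+ (f i) (g i)))
        (∑-distrib-+ (λ i → sum (f i)) (λ i → sum (g i)))

∑∑-separable : ∀ {m n} (f : Fin m → ℤ) (g : Fin n → ℤ) →
  ∑[ i < m ] ∑[ j < n ] (f i * g j) ≡ sum f * sum g
∑∑-separable f g =
  trans (sum-cong-≗ (λ i → Eq.sym (*-distribˡ-sum (f i) g))) (Eq.sym (*-distribʳ-sum (sum g) f))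

powerSum : ∀ {n} → (Fin n → ℤ) → ℕ → ℤ
powerSum {n} f k = ∑[ i < n ] (f i ^ k)

infix 6 _·x^_·y^_
record Monomial : Set where
  constructor _·x^_·y^_
  field
    coeff      : ℤ
    xExp yExp  : ℕ

BiPoly : Set
BiPoly = List Monomial

⟦_⟧ : BiPoly → ℤ → ℤ → ℤ
⟦ []                  ⟧ x y = 0ℤ
⟦ (c ·x^ p ·y^ q) ∷ P ⟧ x y = c * x ^ p * y ^ q + ⟦ P ⟧ x y

⟦_⟧ₘ : BiPoly → (ℕ → ℤ) → (ℕ → ℤ) → ℤ
⟦ []                  ⟧ₘ S T = 0ℤ
⟦ (c ·x^ p ·y^ q) ∷ P ⟧ₘ S T = c * S p * T q + ⟦ P ⟧ₘ S T

⟦⟧ₘ-cong : ∀ P {S S′ T T′ : ℕ → ℤ} → (∀ p → S p ≡ S′ p) → (∀ q → T q ≡ T′ q) →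
           ⟦ P ⟧ₘ S T ≡ ⟦ P ⟧ₘ S′ T′
⟦⟧ₘ-cong []                  S≗ T≗ = refl
⟦⟧ₘ-cong ((c ·x^ p ·y^ q) ∷ P) S≗ T≗ =
  cong₂ _+_ (cong₂ (λ s t → c * s * t) (S≗ p) (T≗ q)) (⟦⟧ₘ-cong P S≗ T≗)

∑∑-bipoly : ∀ P {m n} (f : Fin m → ℤ) (g : Fin n → ℤ) →
  ∑[ i < m ] ∑[ j < n ] ⟦ P ⟧ (f i) (g j) ≡ ⟦ P ⟧ₘ (powerSum f) (powerSum g)
∑∑-bipoly []                    {m} {n} f g =
  trans (sum-cong-≗ {m} (λ _ → sum-replicate-zero n)) (sum-replicate-zero m)
∑∑-bipoly ((c ·x^ p ·y^ q) ∷ P) {m} {n} f g = begin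
  ∑[ i < m ] ∑[ j < n ] (c * f i ^ p * g j ^ q + ⟦ P ⟧ (f i) (g j))
    ≡⟨ ∑∑-distrib-+ (λ i j → c * f i ^ p * g j ^ q) (λ i j → ⟦ P ⟧ (f i) (g j)) ⟩
  ∑[ i < m ] ∑[ j < n ] (c * f i ^ p * g j ^ q) + ∑[ i < m ] ∑[ j < n ] ⟦ P ⟧ (f i) (g j)
    ≡⟨ cong₂ _+_ (∑∑-separable (λ i → c * f i ^ p) (λ j → g j ^ q)) (∑∑-bipoly P f g) ⟩
  ∑[ i < m ] (c * f i ^ p) * powerSum g q + ⟦ P ⟧ₘ (powerSum f) (powerSum g)
    ≡⟨ cong (λ s → s * powerSum g q + ⟦ P ⟧ₘ (powerSum f) (powerSum g))
            (Eq.sym (*-distribˡ-sum c (λ i → f i ^ p))) ⟩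
  c * powerSum f p * powerSum g q + ⟦ P ⟧ₘ (powerSum f) (powerSum g) ∎

<ᵇ-exactly-one : ∀ m n → ¬ m ≡ n → b2n (m <ᵇ n) ℕ.+ b2n (n <ᵇ m) ≡ 1
<ᵇ-exactly-one zero    zero    m≢n = ⊥-elim (m≢n refl)
<ᵇ-exactly-one zero    (suc n) m≢n = refl
<ᵇ-exactly-one (suc m) zero    m≢n = refl
<ᵇ-exactly-one (suc m) (suc n) m≢n = <ᵇ-exactly-one m n (λ m≡n → m≢n (cong suc m≡n))

orientedEdge : ∀ {n} → Graph n → Fin n → Fin n → ℤ
orientedEdge G i j = + b2n (adj G i j ∧ (toℕ i <ᵇ toℕ j))

adj-split : ∀ {n} (G : Graph n) i j →
            + b2n (adj G i j) ≡ orientedEdge G i j + orientedEdge G j i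
adj-split G i j rewrite sym G j i with adj G i j in i~j
... | false = refl
... | true  = trans (cong +_ (Eq.sym (<ᵇ-exactly-one (toℕ i) (toℕ j) i≢j)))
                    (ℤP.pos-+ (b2n (toℕ i <ᵇ toℕ j)) (b2n (toℕ j <ᵇ toℕ i)))
  where
  i≢j : ¬ toℕ i ≡ toℕ j
  i≢j i≡j with refl ← toℕ-injective i≡j with () ← trans (Eq.sym i~j) (irrefl G i)

deg : ∀ {n} → Graph n → Fin n → ℤ
deg G v = + degree G v

deg-as-sum : ∀ {n} (G : Graph n) v → deg G v ≡ ∑[ u < n ] (+ b2n (adj G v u))
deg-as-sum G v = pos-sumFin (λ u → b2n (adj G v u))

handshake : ∀ {n} (G : Graph n) → ∑[ v < n ] deg G v ≡ + 2 * + edges G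
handshake {n} G = begin
  ∑[ u < n ] deg G u
    ≡⟨ sum-cong-≗ (λ u → trans (deg-as-sum G u) (sum-cong-≗ (adj-split G u))) ⟩
  ∑[ u < n ] ∑[ v < n ] (orientedEdge G u v + orientedEdge G v u)
    ≡⟨ ∑∑-distrib-+ (orientedEdge G) (λ u v → orientedEdge G v u) ⟩
  E + ∑[ u < n ] ∑[ v < n ] orientedEdge G v u
    ≡⟨ cong (_+_ E) (Eq.sym (∑-comm (orientedEdge G))) ⟩
  E + E
    ≡⟨ double E ⟩
  + 2 * E
    ≡⟨ cong (+ 2 *_) (Eq.sym edges-as-sum) ⟩
  + 2 * + edges G ∎
  where
  E : ℤ
  E = ∑[ u < n ] ∑[ v < n ] orientedEdge G u v
  edges-as-sum : + edges G ≡ E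
  edges-as-sum =
    trans (pos-sumFin (λ u → sumFin (edgeAt u))) (sum-cong-≗ {n} (λ u → pos-sumFin (edgeAt u)))
    where
    edgeAt : Fin n → Fin n → ℕ
    edgeAt u v = b2n (adj G u v ∧ (toℕ u <ᵇ toℕ v))
  double : ∀ x → x + x ≡ + 2 * x
  double = solve 1 (λ x → x :+ x := con (+ 2) :* x) refl

pos-^ : ∀ d k → + (d ℕ.^ k) ≡ (+ d) ^ k
pos-^ d zero    = refl
pos-^ d (suc k) = trans (ℤP.pos-* d (d ℕ.^ k)) (cong (_*_ (+ d)) (pos-^ d k))

pos-powerSum : ∀ {n} (G : Graph n) k → + sumFin (λ v → degree G v ℕ.^ k) ≡ powerSum (deg G) k
pos-powerSum {n} G k =
  trans (pos-sumFin (λ v → degree G v ℕ.^ k)) (sum-cong-≗ {n} (λ v → pos-^ (degree G v) k))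

graphMoments : (n m z f : ℤ) → (ℕ → ℤ) → ℕ → ℤ
graphMoments n m z f h 0 = n
graphMoments n m z f h 1 = + 2 * m
graphMoments n m z f h 2 = z
graphMoments n m z f h 3 = f
graphMoments n m z f h k@(suc (suc (suc (suc _)))) = h k

degreeMoments : ∀ {n} → Graph n → ℕ → ℤ
degreeMoments {n} G = graphMoments (+ n) (+ edges G) (+ M₁ G) (+ F G) (powerSum (deg G))

powerSum-degree : ∀ {n} (G : Graph n) k → powerSum (deg G) k ≡ degreeMoments G k
powerSum-degree {n} G 0 = sum-ones n
powerSum-degree {n} G 1 = trans (sum-cong-≗ {n} (λ v → ℤP.*-identityʳ (deg G v))) (handshake G)
powerSum-degree     G 2 = Eq.sym (pos-powerSum G 2)
powerSum-degree     G 3 = Eq.sym (pos-powerSum G 3)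
powerSum-degree     G (suc (suc (suc (suc _)))) = refl

unionPoly : BiPoly
unionPoly = (1ℤ ·x^ 1 ·y^ 0) ∷ (1ℤ ·x^ 0 ·y^ 1) ∷ (-1ℤ ·x^ 1 ·y^ 1) ∷ []

b2n-∨ : ∀ p q → + b2n (p ∨ q) ≡ ⟦ unionPoly ⟧ (+ b2n p) (+ b2n q)
b2n-∨ true  true  = refl
b2n-∨ true  false = refl
b2n-∨ false true  = refl
b2n-∨ false false = refl

-- Power sums of an adjacency row: the vertex count for k = 0, the degree
-- for k ≥ 1 (a 0/1 value is its own positive power).
rowMoments : ℤ → ℤ → ℕ → ℤ
rowMoments n d zero    = n
rowMoments n d (suc k) = d

powerSum-row : ∀ {n} (G : Graph n) u k →
               powerSum (λ i → + b2n (adj G u i)) k ≡ rowMoments (+ n) (deg G u) k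
powerSum-row {n} G u zero    = sum-ones n
powerSum-row {n} G u (suc k) =
  trans (sum-cong-≗ {n} (λ i → b2n-idempotent (adj G u i))) (Eq.sym (deg-as-sum G u))
  where
  b2n-idempotent : ∀ b → (+ b2n b) ^ suc k ≡ + b2n b
  b2n-idempotent true  = ℤP.^-zeroˡ (suc k)
  b2n-idempotent false = refl

unionPoly-moments : ∀ N₁ N₂ d₁ d₂ →
  ⟦ unionPoly ⟧ₘ (rowMoments N₁ d₁) (rowMoments N₂ d₂) ≡ N₂ * d₁ + N₁ * d₂ - d₁ * d₂
unionPoly-moments = solve 4 (λ N₁ N₂ d₁ d₂ →
  con 1ℤ :* d₁ :* N₂ :+ (con 1ℤ :* N₁ :* d₂ :+ (con -1ℤ :* d₁ :* d₂ :+ con 0ℤ))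
    := N₂ :* d₁ :+ N₁ :* d₂ :- d₁ :* d₂) refl

adj-disjunction : ∀ {n₁ n₂} (G₁ : Graph n₁) (G₂ : Graph n₂) u v i j →
  adj (disjunction G₁ G₂) (combine {n₁} {n₂} u v) (combine i j) ≡ (adj G₁ u i ∨ adj G₂ v j)
adj-disjunction G₁ G₂ u v i j = cong₂ _∨_
  (cong₂ (adj G₁) (cong proj₁ (remQuot-combine u v)) (cong proj₁ (remQuot-combine i j)))
  (cong₂ (adj G₂) (cong proj₂ (remQuot-combine u v)) (cong proj₂ (remQuot-combine i j)))

degree-disjunction : ∀ {n₁ n₂} (G₁ : Graph n₁) (G₂ : Graph n₂) u v →
  deg (disjunction G₁ G₂) (combine u v) ≡
  + n₂ * deg G₁ u + + n₁ * deg G₂ v - deg G₁ u * deg G₂ v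
degree-disjunction {n₁} {n₂} G₁ G₂ u v = begin
  deg D (combine u v)
    ≡⟨ deg-as-sum D (combine u v) ⟩
  sum (λ y → + b2n (adj D (combine u v) y))
    ≡⟨ sum-combine n₁ (λ y → + b2n (adj D (combine u v) y)) ⟩
  ∑[ i < n₁ ] ∑[ j < n₂ ] (+ b2n (adj D (combine u v) (combine i j)))
    ≡⟨ sum-cong-≗ {n₁} (λ i → sum-cong-≗ {n₂} (λ j →
         trans (cong (λ b → + b2n b) (adj-disjunction G₁ G₂ u v i j))
               (b2n-∨ (adj G₁ u i) (adj G₂ v j)))) ⟩
  ∑[ i < n₁ ] ∑[ j < n₂ ] ⟦ unionPoly ⟧ (row₁ i) (row₂ j)
    ≡⟨ ∑∑-bipoly unionPoly row₁ row₂ ⟩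
  ⟦ unionPoly ⟧ₘ (powerSum row₁) (powerSum row₂)
    ≡⟨ ⟦⟧ₘ-cong unionPoly (powerSum-row G₁ u) (powerSum-row G₂ v) ⟩
  ⟦ unionPoly ⟧ₘ (rowMoments (+ n₁) (deg G₁ u)) (rowMoments (+ n₂) (deg G₂ v))
    ≡⟨ unionPoly-moments (+ n₁) (+ n₂) (deg G₁ u) (deg G₂ v) ⟩
  + n₂ * deg G₁ u + + n₁ * deg G₂ v - deg G₁ u * deg G₂ v ∎
  where
  D = disjunction G₁ G₂
  row₁ : Fin n₁ → ℤ
  row₁ i = + b2n (adj G₁ u i)
  row₂ : Fin n₂ → ℤ
  row₂ j = + b2n (adj G₂ v j)

-- The ten monomials of (N₂·x + N₁·y − x·y)³.
cubePoly : ℤ → ℤ → BiPoly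
cubePoly N₁ N₂ =
  (N₂ ^ 3 ·x^ 3 ·y^ 0) ∷ (N₁ ^ 3 ·x^ 0 ·y^ 3) ∷ (-1ℤ ·x^ 3 ·y^ 3) ∷
  (+ 3 * N₂ ^ 2 * N₁ ·x^ 2 ·y^ 1) ∷ (- (+ 3 * N₂ ^ 2) ·x^ 3 ·y^ 1) ∷
  (+ 3 * N₁ ^ 2 * N₂ ·x^ 1 ·y^ 2) ∷ (- (+ 3 * N₁ ^ 2) ·x^ 1 ·y^ 3) ∷
  (+ 3 * N₂ ·x^ 3 ·y^ 2) ∷ (+ 3 * N₁ ·x^ 2 ·y^ 3) ∷
  (- (+ 6 * N₁ * N₂) ·x^ 2 ·y^ 2) ∷ []

cube-expansion : ∀ N₁ N₂ x y → (N₂ * x + N₁ * y - x * y) ^ 3 ≡ ⟦ cubePoly N₁ N₂ ⟧ x y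
cube-expansion = solve 4 (λ N₁ N₂ x y →
  (N₂ :* x :+ N₁ :* y :- x :* y) :^ 3
    := N₂ :^ 3 :* x :^ 3 :* y :^ 0 :+ (N₁ :^ 3 :* x :^ 0 :* y :^ 3 :+ (con -1ℤ :* x :^ 3 :* y :^ 3 :+
       (con (+ 3) :* N₂ :^ 2 :* N₁ :* x :^ 2 :* y :^ 1 :+ (:- (con (+ 3) :* N₂ :^ 2) :* x :^ 3 :* y :^ 1 :+
       (con (+ 3) :* N₁ :^ 2 :* N₂ :* x :^ 1 :* y :^ 2 :+ (:- (con (+ 3) :* N₁ :^ 2) :* x :^ 1 :* y :^ 3 :+
       (con (+ 3) :* N₂ :* x :^ 3 :* y :^ 2 :+ (con (+ 3) :* N₁ :* x :^ 2 :* y :^ 3 :+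
       (:- (con (+ 6) :* N₁ :* N₂) :* x :^ 2 :* y :^ 2 :+ con 0ℤ)))))))))) refl

cube-moments : ∀ N₁ N₂ m₁ m₂ z₁ z₂ f₁ f₂ (h₁ h₂ : ℕ → ℤ) →
  ⟦ cubePoly N₁ N₂ ⟧ₘ (graphMoments N₁ m₁ z₁ f₁ h₁) (graphMoments N₂ m₂ z₂ f₂ h₂) ≡
    N₂ ^ 4 * f₁ + N₁ ^ 4 * f₂ - f₁ * f₂
    + + 6 * N₁ * N₂ ^ 2 * m₂ * z₁
    + + 6 * N₁ ^ 2 * N₂ * m₁ * z₂
    + + 3 * N₂ * f₁ * z₂
    + + 3 * N₁ * f₂ * z₁
    - + 6 * N₂ ^ 2 * m₂ * f₁
    - + 6 * N₁ ^ 2 * m₁ * f₂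
    - + 6 * N₁ * N₂ * z₁ * z₂
cube-moments N₁ N₂ m₁ m₂ z₁ z₂ f₁ f₂ _ _ = solve 8 (λ N₁ N₂ m₁ m₂ z₁ z₂ f₁ f₂ →
  N₂ :^ 3 :* f₁ :* N₂ :+ (N₁ :^ 3 :* N₁ :* f₂ :+ (con -1ℤ :* f₁ :* f₂ :+
  (con (+ 3) :* N₂ :^ 2 :* N₁ :* z₁ :* (con (+ 2) :* m₂) :+
  (:- (con (+ 3) :* N₂ :^ 2) :* f₁ :* (con (+ 2) :* m₂) :+
  (con (+ 3) :* N₁ :^ 2 :* N₂ :* (con (+ 2) :* m₁) :* z₂ :+
  (:- (con (+ 3) :* N₁ :^ 2) :* (con (+ 2) :* m₁) :* f₂ :+
  (con (+ 3) :* N₂ :* f₁ :* z₂ :+ (con (+ 3) :* N₁ :* z₁ :* f₂ :+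
  (:- (con (+ 6) :* N₁ :* N₂) :* z₁ :* z₂ :+ con 0ℤ)))))))))
    := N₂ :^ 4 :* f₁ :+ N₁ :^ 4 :* f₂ :- f₁ :* f₂
       :+ con (+ 6) :* N₁ :* N₂ :^ 2 :* m₂ :* z₁
       :+ con (+ 6) :* N₁ :^ 2 :* N₂ :* m₁ :* z₂
       :+ con (+ 3) :* N₂ :* f₁ :* z₂
       :+ con (+ 3) :* N₁ :* f₂ :* z₁
       :- con (+ 6) :* N₂ :^ 2 :* m₂ :* f₁
       :- con (+ 6) :* N₁ :^ 2 :* m₁ :* f₂
       :- con (+ 6) :* N₁ :* N₂ :* z₁ :* z₂) refl N₁ N₂ m₁ m₂ z₁ z₂ f₁ f₂

theorem10 : ∀ {n₁ n₂ : ℕ} (G₁ : Graph n₁) (G₂ : Graph n₂) →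
  Connected G₁ → Connected G₂ →
  + F (disjunction G₁ G₂) ≡
    (+ n₂) ^ 4 * + F G₁ + (+ n₁) ^ 4 * + F G₂ - + F G₁ * + F G₂
    + + 6 * + n₁ * (+ n₂) ^ 2 * + edges G₂ * + M₁ G₁
    + + 6 * (+ n₁) ^ 2 * + n₂ * + edges G₁ * + M₁ G₂
    + + 3 * + n₂ * + F G₁ * + M₁ G₂
    + + 3 * + n₁ * + F G₂ * + M₁ G₁
    - + 6 * (+ n₂) ^ 2 * + edges G₂ * + F G₁
    - + 6 * (+ n₁) ^ 2 * + edges G₁ * + F G₂
    - + 6 * + n₁ * + n₂ * + M₁ G₁ * + M₁ G₂
theorem10 {n₁} {n₂} G₁ G₂ _ _ = begin
  + F D
    ≡⟨ Eq.sym (powerSum-degree D 3) ⟩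
  powerSum (deg D) 3
    ≡⟨ sum-combine n₁ (λ x → deg D x ^ 3) ⟩
  ∑[ i < n₁ ] ∑[ j < n₂ ] (deg D (combine i j) ^ 3)
    ≡⟨ sum-cong-≗ {n₁} (λ i → sum-cong-≗ {n₂} (λ j →
         trans (cong (_^ 3) (degree-disjunction G₁ G₂ i j)) (cube-expansion N₁ N₂ _ _))) ⟩
  ∑[ i < n₁ ] ∑[ j < n₂ ] ⟦ cubePoly N₁ N₂ ⟧ (deg G₁ i) (deg G₂ j)
    ≡⟨ ∑∑-bipoly (cubePoly N₁ N₂) (deg G₁) (deg G₂) ⟩
  ⟦ cubePoly N₁ N₂ ⟧ₘ (powerSum (deg G₁)) (powerSum (deg G₂))
    ≡⟨ ⟦⟧ₘ-cong (cubePoly N₁ N₂) (powerSum-degree G₁) (powerSum-degree G₂) ⟩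
  ⟦ cubePoly N₁ N₂ ⟧ₘ (degreeMoments G₁) (degreeMoments G₂)
    ≡⟨ cube-moments N₁ N₂ (+ edges G₁) (+ edges G₂) (+ M₁ G₁) (+ M₁ G₂) (+ F G₁) (+ F G₂)
                   (powerSum (deg G₁)) (powerSum (deg G₂)) ⟩
  _ ∎
  where
  D  = disjunction G₁ G₂
  N₁ = + n₁
  N₂ = + n₂
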